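{- For $n\ge 1$, $a_n(13;2\to 1)=B_n$, the $n$-th Bell number.
   Context: Standard cycle form of $\sigma\in S_n$: product of disjoint cycles (fixed points included), each cycle starting with its largest element, cycles listed in increasing order of largest elements. The fundamental bijection $\theta:S_n\to S_n$ erases the parentheses of the standard cycle form to give a one-line permutation. For $\pi\in S_n$, $\hat\pi=\theta^{ -1}(\pi)$. An arrow pattern $(\nu;H)$ of size $k$: a string $\nu=a_1\dots a_m$ of positive integers and a set $H$ of arrows $b\to c$, with all integers appearing forming $[k]$. $\pi\in S_n$ contains $(\nu;H)$ if there is $X=\{x_1<\dots<x_k\}\subseteq[n]$ with positions $t_1<\dots<t_m$ such that $\pi_{t_1}\cdots\pi_{t_m}=x_{a_1}\cdots x_{a_m}$ and $\hat\pi(x_b)=x_c$ for every arrow $b\to c\in H$; otherwise it avoids it. $a_n(\nu;H)$ = number of $\pi\in S_n$ avoiding $(\nu;H)$. $B_n$ is the number of set partitions of $[n]$. -}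

module Defs where

open import Data.Nat using (ℕ; zero; suc; _+_; _*_; _∸_; _≤?_; _≟_)
open import Data.Bool using (true; false; if_then_else_)
open import Data.Product using (_×_; _,_)
open import Data.List using (List; []; _∷_; map; _++_; concat; concatMap; filter; length; upTo)
open import Data.List.Properties using (≡-dec)
open import Data.List.Relation.Unary.All using (All; all?)
open import Data.List.Relation.Unary.Any using (Any; any?)
open import Data.List.Relation.Binary.Sublist.Propositional using (_⊆_)
open import Data.List.Relation.Binary.Sublist.DecPropositional _≟_ using (_⊆?_)
open import Relation.Nullary using (Dec; yes; no; ¬?)
open import Relation.Nullary.Decidable using (_×-dec_; ⌊_⌋)
open import Relation.Binary.PropositionalEquality using (_≡_)

-- Permutations of [n] in one-line notation: a list of the values
-- σ(1) σ(2) … σ(n).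

range1 : ℕ → List ℕ
range1 n = map suc (upTo n)

nthD : List ℕ → ℕ → ℕ
nthD []       _       = 0
nthD (x ∷ _)  zero    = x
nthD (_ ∷ xs) (suc i) = nthD xs i

-- 1-based lookup: at l i = l_i (the i-th entry), default 0
at : List ℕ → ℕ → ℕ
at l i = nthD l (i ∸ 1)

ins : ℕ → List ℕ → List (List ℕ)
ins x []       = (x ∷ []) ∷ []
ins x (y ∷ ys) = (x ∷ y ∷ ys) ∷ map (y ∷_) (ins x ys)

perms : List ℕ → List (List ℕ)
perms []       = [] ∷ []
perms (x ∷ xs) = concatMap (ins x) (perms xs)

Sym : ℕ → List (List ℕ)
Sym n = perms (range1 n)

cycleOf : ℕ → List ℕ → ℕ → List ℕ
cycleOf n σ m = m ∷ go n (at σ m)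
  where
  go : ℕ → ℕ → List ℕ
  go zero    _ = []
  go (suc f) x with x ≟ m
  ... | yes _ = []
  ... | no  _ = x ∷ go f (at σ x)

-- standard cycle form: each cycle (fixed points included) written
-- starting with its largest element, cycles in increasing order of
-- their largest elements.
standardCycleForm : ℕ → List ℕ → List (List ℕ)
standardCycleForm n σ =
  map (cycleOf n σ) (filter (λ m → all? (_≤? m) (cycleOf n σ m)) (range1 n))

θ : ℕ → List ℕ → List ℕ
θ n σ = concat (standardCycleForm n σ)

-- θ⁻¹(π) : the (unique) σ ∈ S_n with θ σ = π
firstD : List (List ℕ) → List ℕ
firstD []      = []
firstD (x ∷ _) = x

hat : ℕ → List ℕ → List ℕ
hat n π = firstD (filter (λ σ → ≡-dec _≟_ (θ n σ) π) (Sym n))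

record ArrowPattern : Set where
  constructor ⟨_,_,_⟩
  field
    size   : ℕ
    word   : List ℕ
    arrows : List (ℕ × ℕ)    -- H, an arrow b → c is the pair (b , c)
open ArrowPattern public

choose : ℕ → List ℕ → List (List ℕ)
choose zero    _        = [] ∷ []
choose (suc k) []       = []
choose (suc k) (x ∷ xs) = map (x ∷_) (choose k xs) ++ choose (suc k) xs

-- X = x₁ < … < x_k is a list; x_a = at X a.
-- "π_{t₁} … π_{t_m} = x_{a₁} … x_{a_m} for some t₁ < … < t_m" is
-- "the word x_{a₁} … x_{a_m} is a subsequence (sublist) of π".
Occurs : ℕ → List ℕ → ArrowPattern → List ℕ → Set
Occurs n π p X =
  (map (at X) (word p) ⊆ π) ×
  All (λ { (b , c) → at (hat n π) (at X b) ≡ at X c }) (arrows p)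

Contains : ℕ → List ℕ → ArrowPattern → Set
Contains n π p = Any (Occurs n π p) (choose (size p) (range1 n))

contains? : ∀ n π p → Dec (Contains n π p)
contains? n π p = any? (λ X → (map (at X) (word p) ⊆? π)
                              ×-dec all? (λ { (b , c) → at (hat n π) (at X b) ≟ at X c }) (arrows p))
                       (choose (size p) (range1 n))

avoidCount : ℕ → ArrowPattern → ℕ
avoidCount n p = length (filter (λ π → ¬? (contains? n π p)) (Sym n))

stirling2 : ℕ → ℕ → ℕ
stirling2 zero    zero    = 1
stirling2 zero    (suc k) = 0
stirling2 (suc n) zero    = 0
stirling2 (suc n) (suc k) = suc k * stirling2 n (suc k) + stirling2 n k

sumTo : ℕ → (ℕ → ℕ) → ℕ
sumTo zero    f = f 0
sumTo (suc m) f = sumTo m f + f (suc m)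

Bell : ℕ → ℕ
Bell n = sumTo n (stirling2 n)

pat13-2→1 : ArrowPattern
pat13-2→1 = ⟨ 3 , 1 ∷ 3 ∷ [] , (2 , 1) ∷ [] ⟩

{-# OPTIONS --safe #-}

-- The word π = θ σ lists the cycles of σ, each starting with its maximum, in increasing order of
-- maxima. So an adjacent pair a b of π with b < a lies inside one cycle, whence σ a = b; conversely
-- σ a = b < a puts b right after a, since a is not the maximum of its cycle. Every π ∈ S_n is some
-- θ σ (cut π before each left-to-right maximum to get the cycles of σ), so π contains (13 ; 2 → 1)
-- iff some descent top of π is followed later by a larger entry: π avoids the pattern iff each of
-- its descent tops is a right-to-left maximum.
--
-- Such permutations with s right-to-left maxima are counted by S(n, s): inserting a new minimum
-- keeps the property only at the front or right after a right-to-left maximum, and only the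
-- insertion at the very end adds a right-to-left maximum. This is the recurrence
-- S(n + 1, s) = s S(n, s) + S(n, s − 1); summing over s gives B_n.
module Submission where

open import Defs
open import Data.Bool using (Bool; true; false; _∧_; _∨_)
open import Data.Bool.ListAction using (all)
open import Data.Bool.Properties using (∧-zeroʳ; ∨-zeroʳ; ∧-conicalʳ; T-≡; ¬-not)
open import Data.Nat using (ℕ; zero; suc; _+_; _*_; _≤_; _<_; _≤ᵇ_; _≡ᵇ_; _≟_; _≤?_; z≤n; s≤s)
open import Data.Nat.Properties
open import Data.Nat.ListAction using (sum)
open import Data.Nat.ListAction.Properties using (sum-++)
open import Data.Nat.Tactic.RingSolver using (solve-∀)
open import Data.Product using (∃; _×_; _,_; proj₁; proj₂)
open import Data.Sum using (_⊎_; inj₁; inj₂)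
open import Data.List using (List; []; _∷_; _++_; map; concat; concatMap; filter; length; upTo; applyUpTo)
open import Data.List.Properties
  using (map-∘; map-cong-local; map-++; map-concatMap; concatMap-cong; concatMap-map; length-map; length-upTo;
         length-++-≤ˡ; length-++-≤ʳ; ++-assoc; ∷-injective; ≡-dec)
open import Data.List.Membership.Propositional using (_∈_; _∉_; find; lose)
open import Data.List.Membership.Propositional.Properties
  using (∈-map⁺; ∈-map⁻; ∈-upTo⁻; ∈-∃++; ∈-++⁺ˡ; ∈-++⁺ʳ; ∈-++⁻; ∈-concatMap⁺; ∈-concatMap⁻; ∈-filter⁺; ∈-filter⁻)
open import Data.List.Relation.Unary.All as All using (All; []; _∷_; all?)
import Data.List.Relation.Unary.All.Properties as Allₚ
open import Data.List.Relation.Unary.Any as Any using (here; there)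
open import Data.List.Relation.Unary.AllPairs as AllPairs using (AllPairs; []; _∷_)
import Data.List.Relation.Unary.AllPairs.Properties as AllPairsₚ
open import Data.List.Relation.Unary.Unique.Propositional using (Unique)
open import Data.List.Relation.Binary.Subset.Propositional using () renaming (_⊆_ to _⊆ₛ_)
open import Data.List.Relation.Binary.Sublist.Propositional as Sublist
  using (_⊆_; []; _∷_; _∷ʳ_; minimum; from∈; ⊆-antisym)
open import Data.List.Relation.Binary.Sublist.Propositional.Properties
  using (All-resp-⊆; all⊆concat; length-mono-≤)
open import Data.List.Relation.Binary.Permutation.Propositional
  using (_↭_; prep; swap; ↭-refl; ↭-sym; ↭-trans; ↭⇒↭ₛ)
open import Data.List.Relation.Binary.Permutation.Propositional.Properties
  using (↭-length; drop-mid; ∈-resp-↭; ↭-empty-inv; All-resp-↭; ++-comm) renaming (shift to ↭-shift)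
import Data.List.Relation.Binary.Permutation.Setoid.Properties as Permₛ
open import Function using (_∘_; _⇔_; mk⇔; Equivalence)
open import Relation.Nullary using (¬_; yes; no; contradiction)
open import Relation.Unary using (Decidable)
open import Relation.Binary.PropositionalEquality
  using (_≡_; _≢_; _≗_; refl; sym; trans; cong; cong₂; subst; setoid; module ≡-Reasoning)

sorted⇒unique : ∀ {xs : List ℕ} → AllPairs _<_ xs → Unique xs
sorted⇒unique = AllPairs.map <⇒≢

AllPairs-resp-⊇ : ∀ {A : Set} {R : A → A → Set} {xs ys : List A} → xs ⊆ ys → AllPairs R ys → AllPairs R xs
AllPairs-resp-⊇ []             []         = []
AllPairs-resp-⊇ (y ∷ʳ xs⊆ys)   (_ ∷ rys)  = AllPairs-resp-⊇ xs⊆ys rys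
AllPairs-resp-⊇ (refl ∷ xs⊆ys) (ry ∷ rys) = All-resp-⊆ xs⊆ys ry ∷ AllPairs-resp-⊇ xs⊆ys rys

Unique-resp-↭ : ∀ {A : Set} {xs ys : List A} → xs ↭ ys → Unique xs → Unique ys
Unique-resp-↭ {A} p = Permₛ.Unique-resp-↭ (setoid A) (↭⇒↭ₛ p)

unique-⊆ₛ-length⇒↭ : ∀ {A : Set} {xs ys : List A} →
  Unique xs → xs ⊆ₛ ys → length xs ≡ length ys → xs ↭ ys
unique-⊆ₛ-length⇒↭ {xs = []}     {[]} _ _ _ = ↭-refl
unique-⊆ₛ-length⇒↭ {xs = x ∷ xs} (x∉xs ∷ u) xs⊆ys len with ∈-∃++ (xs⊆ys (here refl))
... | A , B , refl = ↭-trans (prep x (unique-⊆ₛ-length⇒↭ u xs⊆AB lenAB)) (↭-sym (↭-shift x A B))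
  where
  xs⊆AB : xs ⊆ₛ A ++ B
  xs⊆AB v∈xs = Any.tail (λ v≡x → All.lookup x∉xs v∈xs (sym v≡x))
                         (∈-resp-↭ (↭-shift x A B) (xs⊆ys (there v∈xs)))
  lenAB : length xs ≡ length (A ++ B)
  lenAB = suc-injective (trans len (↭-length (↭-shift x A B)))

sorted-⊆ₛ⇒⊆ : ∀ {xs ys : List ℕ} → AllPairs _<_ xs → AllPairs _<_ ys → xs ⊆ₛ ys → xs ⊆ ys
sorted-⊆ₛ⇒⊆ {[]} _ _ _ = minimum _
sorted-⊆ₛ⇒⊆ {x ∷ xs} {[]} _ _ xs⊆ys with xs⊆ys (here refl)
... | ()
sorted-⊆ₛ⇒⊆ {x ∷ xs} {y ∷ ys} (x<xs ∷ sxs) (y<ys ∷ sys) xs⊆ys with xs⊆ys (here refl)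
... | here refl   = refl ∷ sorted-⊆ₛ⇒⊆ sxs sys
                      (λ u∈xs → Any.tail (>⇒≢ (All.lookup x<xs u∈xs)) (xs⊆ys (there u∈xs)))
... | there x∈ys = y ∷ʳ sorted-⊆ₛ⇒⊆ (x<xs ∷ sxs) sys
                      (λ u∈ → Any.tail (>⇒≢ (<-≤-trans (All.lookup y<ys x∈ys) (head≤ u∈))) (xs⊆ys u∈))
  where
  head≤ : ∀ {u} → u ∈ x ∷ xs → x ≤ u
  head≤ (here refl)  = ≤-refl
  head≤ (there u∈xs) = <⇒≤ (All.lookup x<xs u∈xs)

∈-choose⁻ : ∀ k L {X} → X ∈ choose k L → X ⊆ L × length X ≡ k
∈-choose⁻ zero    L        (here refl) = minimum L , refl
∈-choose⁻ (suc k) (x ∷ xs) X∈ with ∈-++⁻ (map (x ∷_) (choose k xs)) X∈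
... | inj₁ X∈withX with ∈-map⁻ (x ∷_) X∈withX
...   | Y , Y∈ , refl = let Y⊆xs , lenY = ∈-choose⁻ k xs Y∈ in refl ∷ Y⊆xs , cong suc lenY
∈-choose⁻ (suc k) (x ∷ xs) X∈ | inj₂ X∈withoutX =
  let X⊆xs , lenX = ∈-choose⁻ (suc k) xs X∈withoutX in x ∷ʳ X⊆xs , lenX

∈-choose⁺ : ∀ {X L : List ℕ} → X ⊆ L → X ∈ choose (length X) L
∈-choose⁺ []                   = here refl
∈-choose⁺ {[]}    (y ∷ʳ X⊆L)   = here refl
∈-choose⁺ {x ∷ X} (y ∷ʳ X⊆L)   = ∈-++⁺ʳ (map (y ∷_) (choose (length X) _)) (∈-choose⁺ X⊆L)
∈-choose⁺         (refl ∷ X⊆L) = ∈-++⁺ˡ (∈-map⁺ (_ ∷_) (∈-choose⁺ X⊆L))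

firstD-filter : ∀ {P : List ℕ → Set} (P? : Decidable P) {xs x} → x ∈ xs → P x → P (firstD (filter P? xs))
firstD-filter P? {y ∷ ys} x∈ px with P? y
firstD-filter P? {y ∷ ys} _           _  | yes py  = py
firstD-filter P? {y ∷ ys} (here refl) px | no  ¬py = contradiction px ¬py
firstD-filter P? {y ∷ ys} (there x∈)  px | no  _   = firstD-filter P? x∈ px

range1-sorted : ∀ n → AllPairs _<_ (range1 n)
range1-sorted n = AllPairsₚ.map⁺ (AllPairsₚ.applyUpTo⁺₁ (λ i → i) n (λ i<j _ → s≤s i<j))

length-range1 : ∀ n → length (range1 n) ≡ n
length-range1 n = trans (length-map suc (upTo n)) (length-upTo n)

nthD-map-applyUpTo : ∀ (g f : ℕ → ℕ) {n i} → i < n → nthD (map g (applyUpTo f n)) i ≡ g (f i)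
nthD-map-applyUpTo g f {suc n} {zero}  _         = refl
nthD-map-applyUpTo g f {suc n} {suc i} (s≤s i<n) = nthD-map-applyUpTo g (f ∘ suc) i<n

at-map-range1 : ∀ (g : ℕ → ℕ) {n u} → u ∈ range1 n → at (map g (range1 n)) u ≡ g u
at-map-range1 g {n} u∈ with ∈-map⁻ suc u∈
... | i , i∈ , refl = trans (cong (λ l → nthD l i) (sym (map-∘ (upTo n))))
                            (nthD-map-applyUpTo (g ∘ suc) (λ j → j) (∈-upTo⁻ i∈))

∈-ins⇒↭ : ∀ {x} ys {π} → π ∈ ins x ys → π ↭ x ∷ ys
∈-ins⇒↭ []       (here refl) = ↭-refl
∈-ins⇒↭ (y ∷ ys) (here refl) = ↭-refl
∈-ins⇒↭ {x} (y ∷ ys) (there π∈) with ∈-map⁻ (y ∷_) π∈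
... | ρ , ρ∈ , refl = ↭-trans (prep y (∈-ins⇒↭ ys ρ∈)) (swap y x ↭-refl)

∈-perms⇒↭ : ∀ L {π} → π ∈ perms L → π ↭ L
∈-perms⇒↭ []       (here refl) = ↭-refl
∈-perms⇒↭ (x ∷ xs) π∈ with find (∈-concatMap⁻ (ins x) {xs = perms xs} π∈)
... | τ , τ∈ , π∈ins = ↭-trans (∈-ins⇒↭ τ π∈ins) (prep x (∈-perms⇒↭ xs τ∈))

∈-ins : ∀ x A B → A ++ x ∷ B ∈ ins x (A ++ B)
∈-ins x []      []      = here refl
∈-ins x []      (b ∷ B) = here refl
∈-ins x (a ∷ A) B       = there (∈-map⁺ (a ∷_) (∈-ins x A B))

↭⇒∈-perms : ∀ L {π} → π ↭ L → π ∈ perms L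
↭⇒∈-perms []       π↭[] rewrite ↭-empty-inv π↭[] = here refl
↭⇒∈-perms (x ∷ xs) π↭ with ∈-∃++ (∈-resp-↭ (↭-sym π↭) (here refl))
... | A , B , refl = ∈-concatMap⁺ (ins x) (lose (↭⇒∈-perms xs (drop-mid A [] π↭)) (∈-ins x A B))

module _ (n : ℕ) {π} (π∈ : π ∈ Sym n) where

  Sym⇒↭ : π ↭ range1 n
  Sym⇒↭ = ∈-perms⇒↭ (range1 n) π∈

  Sym⇒unique : Unique π
  Sym⇒unique = Unique-resp-↭ (↭-sym Sym⇒↭) (sorted⇒unique (range1-sorted n))

  Sym⇒length : length π ≡ n
  Sym⇒length = trans (↭-length Sym⇒↭) (length-range1 n)

  Sym⇒⊆ₛ : π ⊆ₛ range1 n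
  Sym⇒⊆ₛ = ∈-resp-↭ Sym⇒↭

  Sym⇒⊇ₛ : range1 n ⊆ₛ π
  Sym⇒⊇ₛ = ∈-resp-↭ (↭-sym Sym⇒↭)

-- Counting by right-to-left maxima

𝟙 : Bool → ℕ
𝟙 true  = 1
𝟙 false = 0

length-filter≡sum-𝟙 : ∀ {A : Set} {P : A → Set} (P? : Decidable P) (b : A → Bool) l →
  (∀ {a} → a ∈ l → P a ⇔ (b a ≡ true)) → length (filter P? l) ≡ sum (map (𝟙 ∘ b) l)
length-filter≡sum-𝟙 P? b []      _   = refl
length-filter≡sum-𝟙 P? b (a ∷ l) P⇔b with P? a
... | yes pa rewrite Equivalence.to (P⇔b (here refl)) pa = cong suc (length-filter≡sum-𝟙 P? b l (P⇔b ∘ there))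
... | no ¬pa with b a in ba
...   | true  = contradiction (Equivalence.from (P⇔b (here refl)) ba) ¬pa
...   | false = length-filter≡sum-𝟙 P? b l (P⇔b ∘ there)

≤ᵇ-true : ∀ {m n} → m ≤ n → (m ≤ᵇ n) ≡ true
≤ᵇ-true m≤n = Equivalence.to T-≡ (≤⇒≤ᵇ m≤n)

≤ᵇ-false : ∀ {m n} → ¬ m ≤ n → (m ≤ᵇ n) ≡ false
≤ᵇ-false {m} {n} m≰n = ¬-not (m≰n ∘ ≤ᵇ⇒≤ m n ∘ Equivalence.from T-≡)

≤ᵇ-false⁻ : ∀ {m n} → (m ≤ᵇ n) ≡ false → n < m
≤ᵇ-false⁻ m≰ᵇn = ≰⇒> (λ m≤n → contradiction (trans (sym (≤ᵇ-true m≤n)) m≰ᵇn) λ ())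

isRLMax : ℕ → List ℕ → Bool
isRLMax y = all (_≤ᵇ y)

descentTopOK : ℕ → List ℕ → Bool
descentTopOK y []       = true
descentTopOK y (z ∷ zs) = (y ≤ᵇ z) ∨ isRLMax y zs

descentTopsRLMax : List ℕ → Bool
descentTopsRLMax []       = true
descentTopsRLMax (y ∷ ys) = descentTopOK y ys ∧ descentTopsRLMax ys

rlMaxCount : List ℕ → ℕ
rlMaxCount []       = 0
rlMaxCount (y ∷ ys) = 𝟙 (isRLMax y ys) + rlMaxCount ys

profile : List ℕ → ℕ → ℕ
profile π s = 𝟙 (descentTopsRLMax π ∧ (rlMaxCount π ≡ᵇ s))

Σprofile : List (List ℕ) → ℕ → ℕ
Σprofile πs s = sum (map (λ π → profile π s) πs)

shift : (ℕ → ℕ) → ℕ → ℕ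
shift f zero    = 0
shift f (suc s) = f s

stirlingStep : (ℕ → ℕ) → ℕ → ℕ
stirlingStep f s = s * f s + shift f s

stirling2-suc : ∀ n → stirling2 (suc n) ≗ stirlingStep (stirling2 n)
stirling2-suc n zero    = refl
stirling2-suc n (suc s) = refl

shift-cong : ∀ {f g} → f ≗ g → shift f ≗ shift g
shift-cong f≗g zero    = refl
shift-cong f≗g (suc s) = f≗g s

stirlingStep-cong : ∀ {f g} → f ≗ g → stirlingStep f ≗ stirlingStep g
stirlingStep-cong f≗g s = cong₂ _+_ (cong (s *_) (f≗g s)) (shift-cong f≗g s)

stirlingStep-zero : ∀ s → stirlingStep (λ _ → 0) s ≡ 0
stirlingStep-zero zero    = refl
stirlingStep-zero (suc s) = trans (+-identityʳ _) (*-zeroʳ s)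

shift+shift-stirlingStep : ∀ f s → shift f s + shift (stirlingStep f) s ≡ stirlingStep (shift f) s
shift+shift-stirlingStep f zero    = refl
shift+shift-stirlingStep f (suc s) = sym (+-assoc (f s) (s * f s) (shift f s))

sum-map-zero : ∀ {A : Set} (l : List A) → sum (map (λ _ → 0) l) ≡ 0
sum-map-zero []      = refl
sum-map-zero (_ ∷ l) = sum-map-zero l

sum-map-shift : ∀ {A : Set} (w : A → ℕ → ℕ) l →
  ∀ s → sum (map (λ a → shift (w a) s) l) ≡ shift (λ r → sum (map (λ a → w a r) l)) s
sum-map-shift w l zero    = sum-map-zero l
sum-map-shift w l (suc s) = refl

sum-map-stirlingStep : ∀ {A : Set} (w : A → ℕ → ℕ) l → ∀ s →
  sum (map (λ a → stirlingStep (w a) s) l) ≡ stirlingStep (λ r → sum (map (λ a → w a r) l)) s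
sum-map-stirlingStep w [] s = sym (cong₂ _+_ (*-zeroʳ s) (shift-zero s))
  where
  shift-zero : ∀ s → shift (λ _ → 0) s ≡ 0
  shift-zero zero    = refl
  shift-zero (suc s) = refl
sum-map-stirlingStep w (a ∷ l) s = begin
  (s * w a s + shift (w a) s) + sum (map (λ b → stirlingStep (w b) s) l)
    ≡⟨ cong ((s * w a s + shift (w a) s) +_) (sum-map-stirlingStep w l s) ⟩
  (s * w a s + shift (w a) s) + (s * Σw s + shift Σw s)
    ≡⟨ regroup s (w a s) (shift (w a) s) (Σw s) (shift Σw s) ⟩
  s * (w a s + Σw s) + (shift (w a) s + shift Σw s)
    ≡⟨ cong (s * (w a s + Σw s) +_) (shift-+ s) ⟨
  stirlingStep (λ r → w a r + Σw r) s ∎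
  where
  open ≡-Reasoning
  Σw : ℕ → ℕ
  Σw r = sum (map (λ b → w b r) l)
  regroup : ∀ k p q P Q → (k * p + q) + (k * P + Q) ≡ k * (p + P) + (q + Q)
  regroup = solve-∀
  shift-+ : ∀ s → shift (λ r → w a r + Σw r) s ≡ shift (w a) s + shift Σw s
  shift-+ zero    = refl
  shift-+ (suc s) = refl

sum-map-concatMap : ∀ {A B : Set} (g : B → ℕ) (f : A → List B) ts →
  sum (map g (concatMap f ts)) ≡ sum (map (λ t → sum (map g (f t))) ts)
sum-map-concatMap g f []       = refl
sum-map-concatMap g f (t ∷ ts) = begin
  sum (map g (f t ++ concatMap f ts))             ≡⟨ cong sum (map-++ g (f t) (concatMap f ts)) ⟩
  sum (map g (f t) ++ map g (concatMap f ts))     ≡⟨ sum-++ (map g (f t)) _ ⟩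
  sum (map g (f t)) + sum (map g (concatMap f ts)) ≡⟨ cong (sum (map g (f t)) +_) (sum-map-concatMap g f ts) ⟩
  sum (map g (f t)) + sum (map (λ t → sum (map g (f t))) ts) ∎
  where open ≡-Reasoning

profile-ascent : ∀ {x y} ys → x < y → profile (x ∷ y ∷ ys) ≗ profile (y ∷ ys)
profile-ascent ys x<y s rewrite ≤ᵇ-true (<⇒≤ x<y) | ≤ᵇ-false (<⇒≱ x<y) = refl

isRLMax⇒descentTopOK : ∀ y ρ → isRLMax y ρ ≡ true → descentTopOK y ρ ≡ true
isRLMax⇒descentTopOK y []       _   = refl
isRLMax⇒descentTopOK y (z ∷ zs) max = trans (cong ((y ≤ᵇ z) ∨_) (∧-conicalʳ _ _ max)) (∨-zeroʳ _)

profile-rlMax : ∀ y ρ → isRLMax y ρ ≡ true → profile (y ∷ ρ) ≗ shift (profile ρ)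
profile-rlMax y ρ max s rewrite isRLMax⇒descentTopOK y ρ max | max with s
... | zero  = cong 𝟙 (∧-zeroʳ (descentTopsRLMax ρ))
... | suc _ = refl

profile-notRLMax : ∀ y ρ → descentTopOK y ρ ≡ true → isRLMax y ρ ≡ false → profile (y ∷ ρ) ≗ profile ρ
profile-notRLMax y ρ ok notMax s rewrite ok | notMax = refl

profile-badDescent : ∀ y ρ → descentTopOK y ρ ≡ false → profile (y ∷ ρ) ≗ λ _ → 0
profile-badDescent y ρ bad s rewrite bad = refl

descentTopOK-below : ∀ {x y} {zs} → x < y → descentTopOK y (x ∷ zs) ≡ isRLMax y zs
descentTopOK-below x<y rewrite ≤ᵇ-false (<⇒≱ x<y) = refl

Σprofile-map-∷ : ∀ y ρs {g : List ℕ → ℕ → ℕ} → All (λ ρ → profile (y ∷ ρ) ≗ g ρ) ρs →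
  ∀ s → Σprofile (map (y ∷_) ρs) s ≡ sum (map (λ ρ → g ρ s) ρs)
Σprofile-map-∷ y ρs eqs s =
  trans (cong sum (sym (map-∘ ρs))) (cong sum (map-cong-local (All.map (λ eq → eq s) eqs)))

isRLMax-ins : ∀ {x y} zs → x ≤ y → All (λ ρ → isRLMax y ρ ≡ isRLMax y zs) (ins x zs)
isRLMax-ins {x} {y} []       x≤y = cong (_∧ true) (≤ᵇ-true x≤y) ∷ []
isRLMax-ins {x} {y} (z ∷ zs) x≤y =
  cong (_∧ isRLMax y (z ∷ zs)) (≤ᵇ-true x≤y) ∷
  Allₚ.map⁺ (All.map (cong ((z ≤ᵇ y) ∧_)) (isRLMax-ins zs x≤y))

Σprofile-ins-step-rlMax : ∀ {x} y ys → x < y → isRLMax y ys ≡ true →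
  Σprofile (ins x ys) ≗ stirlingStep (profile ys) →
  ∀ s → profile (y ∷ ys) s + Σprofile (map (y ∷_) (ins x ys)) s ≡ stirlingStep (profile (y ∷ ys)) s
Σprofile-ins-step-rlMax {x} y ys x<y max IH s = begin
  profile (y ∷ ys) s + Σprofile (map (y ∷_) (ins x ys)) s
    ≡⟨ cong₂ _+_ (profile-rlMax y ys max s)
                 (Σprofile-map-∷ y (ins x ys) (All.map (λ {ρ} → profile-rlMax y ρ) insertedMax) s) ⟩
  shift (profile ys) s + sum (map (λ ρ → shift (profile ρ) s) (ins x ys))
    ≡⟨ cong (shift (profile ys) s +_) (trans (sum-map-shift profile (ins x ys) s) (shift-cong IH s)) ⟩
  shift (profile ys) s + shift (stirlingStep (profile ys)) s
    ≡⟨ shift+shift-stirlingStep (profile ys) s ⟩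
  stirlingStep (shift (profile ys)) s
    ≡⟨ stirlingStep-cong (profile-rlMax y ys max) s ⟨
  stirlingStep (profile (y ∷ ys)) s ∎
  where
  open ≡-Reasoning
  insertedMax : All (λ ρ → isRLMax y ρ ≡ true) (ins x ys)
  insertedMax = All.map (λ eq → trans eq max) (isRLMax-ins ys (<⇒≤ x<y))

Σprofile-ins-step-badDescent : ∀ {x} y z zs → x < y → isRLMax y (z ∷ zs) ≡ false → descentTopOK y (z ∷ zs) ≡ false →
  ∀ s → profile (y ∷ z ∷ zs) s + Σprofile (map (y ∷_) (ins x (z ∷ zs))) s ≡ stirlingStep (profile (y ∷ z ∷ zs)) s
Σprofile-ins-step-badDescent {x} y z zs x<y notMax bad s = begin
  profile (y ∷ z ∷ zs) s + Σprofile (map (y ∷_) (ins x (z ∷ zs))) s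
    ≡⟨ cong₂ _+_ (profile-badDescent y (z ∷ zs) bad s)
                 (Σprofile-map-∷ y _ (All.map (λ {ρ} → profile-badDescent y ρ) insertedBad) s) ⟩
  0 + sum (map (λ _ → 0) (ins x (z ∷ zs)))
    ≡⟨ sum-map-zero (ins x (z ∷ zs)) ⟩
  0
    ≡⟨ stirlingStep-zero s ⟨
  stirlingStep (λ _ → 0) s
    ≡⟨ stirlingStep-cong (profile-badDescent y (z ∷ zs) bad) s ⟨
  stirlingStep (profile (y ∷ z ∷ zs)) s ∎
  where
  open ≡-Reasoning
  insertedBad : All (λ ρ → descentTopOK y ρ ≡ false) (ins x (z ∷ zs))
  insertedBad = trans (descentTopOK-below {zs = z ∷ zs} x<y) notMax ∷
                Allₚ.map⁺ (All.map (λ eq → trans (cong ((y ≤ᵇ z) ∨_) eq) bad) (isRLMax-ins zs (<⇒≤ x<y)))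

Σprofile-ins-step-goodDescent : ∀ {x} y z zs → x < y → x < z → isRLMax y (z ∷ zs) ≡ false →
  descentTopOK y (z ∷ zs) ≡ true → Σprofile (ins x (z ∷ zs)) ≗ stirlingStep (profile (z ∷ zs)) →
  ∀ s → profile (y ∷ z ∷ zs) s + Σprofile (map (y ∷_) (ins x (z ∷ zs))) s ≡ stirlingStep (profile (y ∷ z ∷ zs)) s
Σprofile-ins-step-goodDescent {x} y z zs x<y x<z notMax ok IH s = begin
  profile (y ∷ z ∷ zs) s + (profile (y ∷ x ∷ z ∷ zs) s + Σprofile (map (y ∷_) (map (z ∷_) (ins x zs))) s)
    ≡⟨ cong₂ _+_ (profile-notRLMax y (z ∷ zs) ok notMax s)
                 (cong₂ _+_ (profile-badDescent y (x ∷ z ∷ zs) (trans (descentTopOK-below {zs = z ∷ zs} x<y) notMax) s)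
                            (Σprofile-map-∷ y _ {profile}
                               (All.map (λ {ρ} (okρ , notMaxρ) → profile-notRLMax y ρ okρ notMaxρ) flags) s)) ⟩
  profile (z ∷ zs) s + Σprofile (map (z ∷_) (ins x zs)) s
    ≡⟨ cong (_+ Σprofile (map (z ∷_) (ins x zs)) s) (profile-ascent zs x<z s) ⟨
  Σprofile (ins x (z ∷ zs)) s
    ≡⟨ IH s ⟩
  stirlingStep (profile (z ∷ zs)) s
    ≡⟨ stirlingStep-cong (profile-notRLMax y (z ∷ zs) ok notMax) s ⟨
  stirlingStep (profile (y ∷ z ∷ zs)) s ∎
  where
  open ≡-Reasoning
  flags : All (λ ρ → descentTopOK y ρ ≡ true × isRLMax y ρ ≡ false) (map (z ∷_) (ins x zs))
  flags = Allₚ.map⁺ (All.map (λ eq → trans (cong ((y ≤ᵇ z) ∨_) eq) ok , trans (cong ((z ≤ᵇ y) ∧_) eq) notMax)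
                             (isRLMax-ins zs (<⇒≤ x<y)))

Σprofile-ins-step-notRLMax : ∀ {x} y ys → x < y → All (x <_) ys → isRLMax y ys ≡ false →
  Σprofile (ins x ys) ≗ stirlingStep (profile ys) →
  ∀ s → profile (y ∷ ys) s + Σprofile (map (y ∷_) (ins x ys)) s ≡ stirlingStep (profile (y ∷ ys)) s
Σprofile-ins-step-notRLMax {x} y (z ∷ zs) x<y (x<z ∷ _) notMax IH s = byDescent (descentTopOK y (z ∷ zs)) refl
  where
  byDescent : ∀ b → descentTopOK y (z ∷ zs) ≡ b →
              profile (y ∷ z ∷ zs) s + Σprofile (map (y ∷_) (ins x (z ∷ zs))) s ≡ stirlingStep (profile (y ∷ z ∷ zs)) s
  byDescent false bad = Σprofile-ins-step-badDescent y z zs x<y notMax bad s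
  byDescent true  ok  = Σprofile-ins-step-goodDescent y z zs x<y x<z notMax ok IH s

Σprofile-ins : ∀ {x} τ → All (x <_) τ → Σprofile (ins x τ) ≗ stirlingStep (profile τ)
Σprofile-ins []       []            zero    = refl
Σprofile-ins []       []            (suc s) = trans (+-identityʳ _) (cong (_+ profile [] s) (sym (*-zeroʳ (suc s))))
Σprofile-ins {x} (y ∷ ys) (x<y ∷ x<ys) s =
  trans (cong (_+ Σprofile (map (y ∷_) (ins x ys)) s) (profile-ascent ys x<y s)) (byRLMax (isRLMax y ys) refl)
  where
  byRLMax : ∀ b → isRLMax y ys ≡ b →
            profile (y ∷ ys) s + Σprofile (map (y ∷_) (ins x ys)) s ≡ stirlingStep (profile (y ∷ ys)) s
  byRLMax true  max    = Σprofile-ins-step-rlMax y ys x<y max (Σprofile-ins ys x<ys) s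
  byRLMax false notMax = Σprofile-ins-step-notRLMax y ys x<y x<ys notMax (Σprofile-ins ys x<ys) s

Σprofile-perms : ∀ L → AllPairs _<_ L → Σprofile (perms L) ≗ stirling2 (length L)
Σprofile-perms []       []              zero    = refl
Σprofile-perms []       []              (suc s) = refl
Σprofile-perms (x ∷ xs) (x<xs ∷ sorted) s = begin
  Σprofile (concatMap (ins x) (perms xs)) s
    ≡⟨ sum-map-concatMap (λ π → profile π s) (ins x) (perms xs) ⟩
  sum (map (λ τ → Σprofile (ins x τ) s) (perms xs))
    ≡⟨ cong sum (map-cong-local (All.tabulate λ τ∈ → Σprofile-ins _ (All-resp-↭ (↭-sym (∈-perms⇒↭ xs τ∈)) x<xs) s)) ⟩
  sum (map (λ τ → stirlingStep (profile τ) s) (perms xs))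
    ≡⟨ sum-map-stirlingStep profile (perms xs) s ⟩
  stirlingStep (Σprofile (perms xs)) s
    ≡⟨ stirlingStep-cong (Σprofile-perms xs sorted) s ⟩
  stirlingStep (stirling2 (length xs)) s
    ≡⟨ stirling2-suc (length xs) s ⟨
  stirling2 (length (x ∷ xs)) s ∎
  where open ≡-Reasoning

Σprofile-Sym : ∀ n → Σprofile (Sym n) ≗ stirling2 n
Σprofile-Sym n s = trans (Σprofile-perms (range1 n) (range1-sorted n) s) (cong (λ k → stirling2 k s) (length-range1 n))

sumTo-cong : ∀ n {f g} → f ≗ g → sumTo n f ≡ sumTo n g
sumTo-cong zero    f≗g = f≗g 0
sumTo-cong (suc n) f≗g = cong₂ _+_ (sumTo-cong n f≗g) (f≗g (suc n))

sumTo-zero : ∀ n → sumTo n (λ _ → 0) ≡ 0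
sumTo-zero zero    = refl
sumTo-zero (suc n) = trans (+-identityʳ _) (sumTo-zero n)

sumTo-+ : ∀ n f g → sumTo n (λ s → f s + g s) ≡ sumTo n f + sumTo n g
sumTo-+ zero    f g = refl
sumTo-+ (suc n) f g = trans (cong (_+ (f (suc n) + g (suc n))) (sumTo-+ n f g))
                            (interchange (sumTo n f) (sumTo n g) (f (suc n)) (g (suc n)))
  where
  interchange : ∀ a b c d → (a + b) + (c + d) ≡ (a + c) + (b + d)
  interchange = solve-∀

sum-map-sumTo : ∀ {A : Set} n (w : A → ℕ → ℕ) l →
  sum (map (λ a → sumTo n (w a)) l) ≡ sumTo n (λ s → sum (map (λ a → w a s) l))
sum-map-sumTo n w []      = sym (sumTo-zero n)
sum-map-sumTo n w (a ∷ l) = trans (cong (sumTo n (w a) +_) (sum-map-sumTo n w l)) (sym (sumTo-+ n (w a) _))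

≡ᵇ-false : ∀ {r s} → r ≢ s → (r ≡ᵇ s) ≡ false
≡ᵇ-false {r} {s} r≢s = ¬-not (r≢s ∘ ≡ᵇ⇒≡ r s ∘ Equivalence.from T-≡)

sumTo-𝟙≡ᵇ-> : ∀ n r → n < r → sumTo n (λ s → 𝟙 (r ≡ᵇ s)) ≡ 0
sumTo-𝟙≡ᵇ-> zero    (suc r) _   = refl
sumTo-𝟙≡ᵇ-> (suc n) r       n<r =
  cong₂ _+_ (sumTo-𝟙≡ᵇ-> n r (<-trans (n<1+n n) n<r)) (cong 𝟙 (≡ᵇ-false (>⇒≢ n<r)))

sumTo-𝟙≡ᵇ : ∀ n r → r ≤ n → sumTo n (λ s → 𝟙 (r ≡ᵇ s)) ≡ 1
sumTo-𝟙≡ᵇ zero    zero z≤n = refl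
sumTo-𝟙≡ᵇ (suc n) r    r≤1+n with m≤n⇒m<n∨m≡n r≤1+n
... | inj₁ (s≤s r≤n) = cong₂ _+_ (sumTo-𝟙≡ᵇ n r r≤n) (cong 𝟙 (≡ᵇ-false (<⇒≢ (s≤s r≤n))))
... | inj₂ refl      =
  cong₂ _+_ (sumTo-𝟙≡ᵇ-> n (suc n) (n<1+n n)) (cong 𝟙 (Equivalence.to T-≡ (≡⇒≡ᵇ n n refl)))

𝟙-descentTopsRLMax : ∀ n π → rlMaxCount π ≤ n → 𝟙 (descentTopsRLMax π) ≡ sumTo n (profile π)
𝟙-descentTopsRLMax n π rl≤n with descentTopsRLMax π
... | true  = sym (sumTo-𝟙≡ᵇ n (rlMaxCount π) rl≤n)
... | false = sym (sumTo-zero n)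

rlMaxCount≤length : ∀ π → rlMaxCount π ≤ length π
rlMaxCount≤length []       = z≤n
rlMaxCount≤length (y ∷ ys) = +-mono-≤ (𝟙≤1 (isRLMax y ys)) (rlMaxCount≤length ys)
  where
  𝟙≤1 : ∀ b → 𝟙 b ≤ 1
  𝟙≤1 true  = ≤-refl
  𝟙≤1 false = z≤n

count-descentTopsRLMax-Sym : ∀ n → sum (map (𝟙 ∘ descentTopsRLMax) (Sym n)) ≡ Bell n
count-descentTopsRLMax-Sym n = begin
  sum (map (𝟙 ∘ descentTopsRLMax) (Sym n))        ≡⟨ cong sum (map-cong-local (All.tabulate bySumTo)) ⟩
  sum (map (λ π → sumTo n (profile π)) (Sym n))   ≡⟨ sum-map-sumTo n profile (Sym n) ⟩
  sumTo n (Σprofile (Sym n))                      ≡⟨ sumTo-cong n (Σprofile-Sym n) ⟩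
  Bell n                                          ∎
  where
  open ≡-Reasoning
  bySumTo : ∀ {π} → π ∈ Sym n → 𝟙 (descentTopsRLMax π) ≡ sumTo n (profile π)
  bySumTo {π} π∈ = 𝟙-descentTopsRLMax n π (subst (rlMaxCount π ≤_) (Sym⇒length n π∈) (rlMaxCount≤length π))

data Adjacent (a b : ℕ) : List ℕ → Set where
  front : ∀ {xs}   → Adjacent a b (a ∷ b ∷ xs)
  skip  : ∀ {x xs} → Adjacent a b xs → Adjacent a b (x ∷ xs)

Adjacent-∈ : ∀ {a b xs} → Adjacent a b xs → a ∈ xs × b ∈ xs
Adjacent-∈ front      = here refl , there (here refl)
Adjacent-∈ (skip adj) with Adjacent-∈ adj
... | a∈ , b∈ = there a∈ , there b∈

Adjacent-++ˡ : ∀ {a b xs} ys → Adjacent a b xs → Adjacent a b (xs ++ ys)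
Adjacent-++ˡ ys front      = front
Adjacent-++ˡ ys (skip adj) = skip (Adjacent-++ˡ ys adj)

Adjacent-++ʳ : ∀ {a b ys} xs → Adjacent a b ys → Adjacent a b (xs ++ ys)
Adjacent-++ʳ []       adj = adj
Adjacent-++ʳ (x ∷ xs) adj = skip (Adjacent-++ʳ xs adj)

Adjacent-++⁻ : ∀ {a b} xs ys → Adjacent a b (xs ++ ys) →
               Adjacent a b xs ⊎ Adjacent a b ys ⊎ (a ∈ xs × ∃ λ zs → ys ≡ b ∷ zs)
Adjacent-++⁻ []            ys       adj        = inj₂ (inj₁ adj)
Adjacent-++⁻ (x ∷ [])      (y ∷ ys) front      = inj₂ (inj₂ (here refl , ys , refl))
Adjacent-++⁻ (x ∷ [])      ys       (skip adj) = inj₂ (inj₁ adj)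
Adjacent-++⁻ (x ∷ x′ ∷ xs) ys       front      = inj₁ front
Adjacent-++⁻ (x ∷ x′ ∷ xs) ys       (skip adj) with Adjacent-++⁻ (x′ ∷ xs) ys adj
... | inj₁ adj′                 = inj₁ (skip adj′)
... | inj₂ (inj₁ adj′)          = inj₂ (inj₁ adj′)
... | inj₂ (inj₂ (a∈ , split)) = inj₂ (inj₂ (there a∈ , split))

record NonRLMaxDescent (π : List ℕ) : Set where
  field
    top bottom larger : ℕ
    adjacent : Adjacent top bottom π
    descent  : bottom < top
    exceeded : top < larger
    followed : bottom ∷ larger ∷ [] ⊆ π

isRLMax-false⁻ : ∀ y zs → isRLMax y zs ≡ false → ∃ λ c → c ∈ zs × y < c
isRLMax-false⁻ y (w ∷ ws) notMax with w ≤ᵇ y in w≤ᵇy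
... | false = w , here refl , ≤ᵇ-false⁻ w≤ᵇy
... | true  with isRLMax-false⁻ y ws notMax
...   | c , c∈ , y<c = c , there c∈ , y<c

isRLMax-false⁺ : ∀ {y c zs} → c ∈ zs → y < c → isRLMax y zs ≡ false
isRLMax-false⁺ (here refl) y<c rewrite ≤ᵇ-false (<⇒≱ y<c) = refl
isRLMax-false⁺ {y} {zs = w ∷ ws} (there c∈) y<c = trans (cong ((w ≤ᵇ y) ∧_) (isRLMax-false⁺ c∈ y<c)) (∧-zeroʳ _)

descentTopsRLMax-false⇒NonRLMaxDescent : ∀ π → descentTopsRLMax π ≡ false → NonRLMaxDescent π
descentTopsRLMax-false⇒NonRLMaxDescent (y ∷ ys) bad with descentTopOK y ys in ok
descentTopsRLMax-false⇒NonRLMaxDescent (y ∷ z ∷ zs) bad | false with y ≤ᵇ z in y≤ᵇz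
... | true  = contradiction ok λ ()
... | false with isRLMax-false⁻ y zs ok
...   | c , c∈ , y<c = record
  { adjacent = front
  ; descent  = ≤ᵇ-false⁻ y≤ᵇz
  ; exceeded = y<c
  ; followed = y ∷ʳ refl ∷ from∈ c∈
  }
descentTopsRLMax-false⇒NonRLMaxDescent (y ∷ ys) bad | true = record
  { adjacent = skip adjacent ; descent = descent ; exceeded = exceeded ; followed = y ∷ʳ followed }
  where open NonRLMaxDescent (descentTopsRLMax-false⇒NonRLMaxDescent ys bad)

NonRLMaxDescent⇒descentTopsRLMax-false : ∀ {π} → Unique π → NonRLMaxDescent π → descentTopsRLMax π ≡ false
NonRLMaxDescent⇒descentTopsRLMax-false unique d = go unique adjacent followed
  where
  open NonRLMaxDescent d
  go : ∀ {π} → Unique π → Adjacent top bottom π → bottom ∷ larger ∷ [] ⊆ π → descentTopsRLMax π ≡ false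
  go (_ ∷ bottom∉ ∷ _) front (_ ∷ʳ _ ∷ʳ bottom∈) =
    contradiction refl (All.lookup bottom∉ (Sublist.lookup bottom∈ (here refl)))
  go {_ ∷ _ ∷ xs} (_ ∷ _ ∷ _) front (_ ∷ʳ refl ∷ larger∈)
    rewrite ≤ᵇ-false (<⇒≱ descent) | isRLMax-false⁺ {top} {larger} {xs} (Sublist.lookup larger∈ (here refl)) exceeded
    = refl
  go (_ ∷ _) front (refl ∷ _) = contradiction refl (<⇒≢ descent)
  go {x ∷ xs} (_ ∷ u) (skip adj) (_ ∷ʳ sub) = trans (cong (descentTopOK x xs ∧_) (go u adj sub)) (∧-zeroʳ _)
  go (x∉ ∷ _) (skip adj) (refl ∷ _) = contradiction refl (All.lookup x∉ (proj₂ (Adjacent-∈ adj)))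

-- Cycles and θ

orbit : List ℕ → ℕ → ℕ → ℕ → List ℕ
orbit σ m zero    y = []
orbit σ m (suc f) y with y ≟ m
... | yes _ = []
... | no  _ = y ∷ orbit σ m f (at σ y)

-- cycleOf's loop is local to its where-block; it is reached as the solution of the metavariable loop.
cycleOf≡orbit : ∀ n σ m → cycleOf n σ m ≡ m ∷ orbit σ m n (at σ m)
cycleOf≡orbit n σ m = trans (unfold n) (cong (m ∷_) (loop≡orbit n (at σ m)))
  where
  loop : ℕ → ℕ → List ℕ
  loop = _
  unfold : ∀ k → cycleOf k σ m ≡ m ∷ loop k (at σ m)
  unfold k with at σ m
  ... | y = refl
  loop≡orbit : ∀ f y → loop f y ≡ orbit σ m f y
  loop≡orbit zero    y = refl
  loop≡orbit (suc f) y with y ≟ m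
  ... | yes _ = refl
  ... | no  _ = cong (y ∷_) (loop≡orbit f (at σ y))

Adjacent-orbit⇒step : ∀ σ m f x {a b} → Adjacent a b (x ∷ orbit σ m f (at σ x)) → at σ a ≡ b
Adjacent-orbit⇒step σ m zero    x (skip ())
Adjacent-orbit⇒step σ m (suc f) x adj with at σ x ≟ m | adj
... | yes _ | skip ()
... | no  _ | front     = refl
... | no  _ | skip adj′ = Adjacent-orbit⇒step σ m f (at σ x) adj′

∈-orbit-next : ∀ σ m f x {a} → a ∈ x ∷ orbit σ m f (at σ x) →
  Adjacent a (at σ a) (x ∷ orbit σ m f (at σ x)) ⊎ at σ a ≡ m ⊎ length (x ∷ orbit σ m f (at σ x)) ≡ suc f
∈-orbit-next σ m zero    x (here refl) = inj₂ (inj₂ refl)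
∈-orbit-next σ m (suc f) x a∈ with at σ x ≟ m | a∈
... | yes σx≡m | here refl  = inj₂ (inj₁ σx≡m)
... | no  _    | here refl  = inj₁ front
... | no  _    | there a∈′ with ∈-orbit-next σ m f (at σ x) a∈′
...   | inj₁ adj          = inj₁ (skip adj)
...   | inj₂ (inj₁ σa≡m)  = inj₂ (inj₁ σa≡m)
...   | inj₂ (inj₂ full)  = inj₂ (inj₂ (cong suc full))

Path : (ℕ → ℕ) → ℕ → List ℕ → ℕ → Set
Path s x []       z = s x ≡ z
Path s x (y ∷ ys) z = s x ≡ y × Path s y ys z

orbit-Path : ∀ σ m x ys f → Path (at σ) x ys m → m ∉ ys → length ys ≤ f → orbit σ m f (at σ x) ≡ ys
orbit-Path σ m x []       zero    _ _ _ = refl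
orbit-Path σ m x []       (suc f) σx≡m _ _ with at σ x ≟ m
... | yes _    = refl
... | no  σx≢m = contradiction σx≡m σx≢m
orbit-Path σ m x (y ∷ ys) (suc f) (refl , path) m∉ (s≤s short) with at σ x ≟ m
... | yes σx≡m = contradiction (here (sym σx≡m)) m∉
... | no  _    = cong (at σ x ∷_) (orbit-Path σ m (at σ x) ys f path (m∉ ∘ there) short)

cycleOf-Path : ∀ n σ m ys → Path (at σ) m ys m → m ∉ ys → length ys ≤ n → cycleOf n σ m ≡ m ∷ ys
cycleOf-Path n σ m ys path m∉ short =
  trans (cycleOf≡orbit n σ m) (cong (m ∷_) (orbit-Path σ m m ys n path m∉ short))

IsCycleMax : ℕ → List ℕ → ℕ → Set
IsCycleMax n σ m = All (_≤ m) (cycleOf n σ m)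

cycleMaxima : ℕ → List ℕ → List ℕ
cycleMaxima n σ = filter (λ m → all? (_≤? m) (cycleOf n σ m)) (range1 n)

cycleMaxima-sorted : ∀ n σ → AllPairs _<_ (cycleMaxima n σ)
cycleMaxima-sorted n σ = AllPairsₚ.filter⁺ _ (range1-sorted n)

∈-cycleMaxima⁻ : ∀ n σ {m} → m ∈ cycleMaxima n σ → m ∈ range1 n × IsCycleMax n σ m
∈-cycleMaxima⁻ n σ = ∈-filter⁻ (λ m → all? (_≤? m) (cycleOf n σ m))

descent⇒step : ∀ n σ {ms a b} → AllPairs _<_ ms → All (IsCycleMax n σ) ms →
               Adjacent a b (concatMap (cycleOf n σ) ms) → b < a → at σ a ≡ b
descent⇒step n σ {m ∷ ms} {a} {b} (m<ms ∷ sorted) (mMax ∷ maxs) adj b<a with Adjacent-++⁻ (cycleOf n σ m) _ adj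
... | inj₁ inCycle          = Adjacent-orbit⇒step σ m n m (subst (Adjacent a b) (cycleOf≡orbit n σ m) inCycle)
... | inj₂ (inj₁ later)     = descent⇒step n σ sorted maxs later b<a
... | inj₂ (inj₂ (a∈ , rest , startsWithB)) = contradiction startsWithB (nextCycle ms m<ms)
  where
  -- the next cycle starts with its maximum m′ > m ≥ a > b
  nextCycle : ∀ ms′ → All (m <_) ms′ → concatMap (cycleOf n σ) ms′ ≢ b ∷ rest
  nextCycle []        _          ()
  nextCycle (m′ ∷ ms′) (m<m′ ∷ _) eq =
    <-irrefl (sym m′≡b) (<-trans b<a (≤-<-trans (All.lookup mMax a∈) m<m′))
    where
    m′≡b : m′ ≡ b
    m′≡b = proj₁ (∷-injective (trans (cong (_++ concatMap (cycleOf n σ) ms′) (sym (cycleOf≡orbit n σ m′))) eq))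

-- The length bound excludes a cycle of cycleOf cut short by its fuel n.
step⇒adjacent : ∀ n σ {ms a} → All (IsCycleMax n σ) ms → a ∈ concatMap (cycleOf n σ) ms → at σ a < a →
                length (concatMap (cycleOf n σ) ms) ≤ n → Adjacent a (at σ a) (concatMap (cycleOf n σ) ms)
step⇒adjacent n σ {m ∷ ms} {a} (mMax ∷ maxs) a∈ σa<a short with ∈-++⁻ (cycleOf n σ m) a∈
... | inj₂ a∈later = Adjacent-++ʳ (cycleOf n σ m)
                       (step⇒adjacent n σ maxs a∈later σa<a (≤-trans (length-++-≤ʳ _ {cycleOf n σ m}) short))
... | inj₁ a∈cycle with ∈-orbit-next σ m n m (subst (a ∈_) (cycleOf≡orbit n σ m) a∈cycle)
...   | inj₁ adj        = Adjacent-++ˡ _ (subst (Adjacent a (at σ a)) (sym (cycleOf≡orbit n σ m)) adj)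
...   | inj₂ (inj₁ σa≡m) = contradiction (All.lookup mMax a∈cycle) (<⇒≱ (subst (_< a) σa≡m σa<a))
...   | inj₂ (inj₂ full) = contradiction (subst (_≤ n) (trans (cong length (cycleOf≡orbit n σ m)) full)
                                                 (≤-trans (length-++-≤ˡ (cycleOf n σ m)) short))
                                         (n≮n n)

-- θ is onto

Block : Set
Block = ℕ × List ℕ

flat : Block → List ℕ
flat (h , T) = h ∷ T

Bounded : Block → Set
Bounded (h , T) = All (_≤ h) T

absorb : ℕ → List Block → List ℕ × List Block
absorb x []             = [] , []
absorb x ((h , T) ∷ bs) with h ≤? x
... | yes _ = (h ∷ T ++ proj₁ (absorb x bs)) , proj₂ (absorb x bs)
... | no  _ = [] , (h , T) ∷ bs

-- π cut before each of its left-to-right maxima; these blocks become the cycles of θ⁻¹ π.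
blocks : List ℕ → List Block
blocks []         = []
blocks (x ∷ rest) = (x , proj₁ (absorb x (blocks rest))) ∷ proj₂ (absorb x (blocks rest))

absorb-flat : ∀ x bs → proj₁ (absorb x bs) ++ concatMap flat (proj₂ (absorb x bs)) ≡ concatMap flat bs
absorb-flat x []             = refl
absorb-flat x ((h , T) ∷ bs) with h ≤? x
... | yes _ = cong (h ∷_) (trans (++-assoc T (proj₁ (absorb x bs)) _) (cong (T ++_) (absorb-flat x bs)))
... | no  _ = refl

blocks-flat : ∀ π → concatMap flat (blocks π) ≡ π
blocks-flat []         = refl
blocks-flat (x ∷ rest) = cong (x ∷_) (trans (absorb-flat x (blocks rest)) (blocks-flat rest))

absorb-bounded : ∀ x bs → All Bounded bs → All (_≤ x) (proj₁ (absorb x bs)) × All Bounded (proj₂ (absorb x bs))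
absorb-bounded x []             [] = [] , []
absorb-bounded x ((h , T) ∷ bs) (T≤h ∷ bounded) with h ≤? x
... | yes h≤x = (h≤x ∷ Allₚ.++⁺ (All.map (λ t≤h → ≤-trans t≤h h≤x) T≤h) (proj₁ (absorb-bounded x bs bounded)))
              , proj₂ (absorb-bounded x bs bounded)
... | no  _   = [] , T≤h ∷ bounded

blocks-bounded : ∀ π → All Bounded (blocks π)
blocks-bounded []         = []
blocks-bounded (x ∷ rest) = proj₁ absorbed ∷ proj₂ absorbed
  where
  absorbed : All (_≤ x) (proj₁ (absorb x (blocks rest))) × All Bounded (proj₂ (absorb x (blocks rest)))
  absorbed = absorb-bounded x (blocks rest) (blocks-bounded rest)

absorb-heads : ∀ x bs → AllPairs _<_ (map proj₁ bs) →
  AllPairs _<_ (map proj₁ (proj₂ (absorb x bs))) × All (x <_) (map proj₁ (proj₂ (absorb x bs)))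
absorb-heads x []             [] = [] , []
absorb-heads x ((h , T) ∷ bs) (h<hs ∷ sorted) with h ≤? x
... | yes _   = absorb-heads x bs sorted
... | no  h≰x = (h<hs ∷ sorted) , (≰⇒> h≰x ∷ All.map (<-trans (≰⇒> h≰x)) h<hs)

blocks-heads-sorted : ∀ π → AllPairs _<_ (map proj₁ (blocks π))
blocks-heads-sorted []         = []
blocks-heads-sorted (x ∷ rest) = proj₂ absorbed ∷ proj₁ absorbed
  where
  absorbed : AllPairs _<_ (map proj₁ (proj₂ (absorb x (blocks rest)))) × All (x <_) (map proj₁ (proj₂ (absorb x (blocks rest))))
  absorbed = absorb-heads x (blocks rest) (blocks-heads-sorted rest)

flat⊆concatMap-flat : ∀ {b} bs → b ∈ bs → flat b ⊆ concatMap flat bs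
flat⊆concatMap-flat bs b∈ = All.lookup (Allₚ.map⁻ (all⊆concat (map flat bs))) b∈

Path-cong : ∀ {f g : ℕ → ℕ} x ys z → (∀ {u} → u ∈ x ∷ ys → f u ≡ g u) → Path g x ys z → Path f x ys z
Path-cong x []       z f≡g path         = trans (f≡g (here refl)) path
Path-cong x (y ∷ ys) z f≡g (gx≡y , path) = trans (f≡g (here refl)) gx≡y , Path-cong y ys z (f≡g ∘ there) path

Path-++⁻ : ∀ {s} x A u B z → Path s x (A ++ u ∷ B) z → Path s x A u × Path s u B z
Path-++⁻ x []      u B z (sx≡u , path) = sx≡u , path
Path-++⁻ x (a ∷ A) u B z (sx≡a , path) with Path-++⁻ a A u B z path
... | toU , fromU = (sx≡a , toU) , fromU

Path-++⁺ : ∀ {s} x A u B z → Path s x A u → Path s u B z → Path s x (A ++ u ∷ B) z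
Path-++⁺ x []      u B z sx≡u        fromU = sx≡u , fromU
Path-++⁺ x (a ∷ A) u B z (sx≡a , toU) fromU = sx≡a , Path-++⁺ a A u B z toU fromU

Path-rotate : ∀ {s} h A u B → Path s h (A ++ u ∷ B) h → Path s u (B ++ h ∷ A) u
Path-rotate h A u B path with Path-++⁻ h A u B h path
... | toU , fromU = Path-++⁺ u B h A u fromU toU

Path-onto : ∀ {s} x ys {w} → Path s x ys x → w ∈ x ∷ ys → ∃ λ u → u ∈ x ∷ ys × s u ≡ w
Path-onto {s} x ys {w} path w∈ = reach x ys path (rotate w∈)
  where
  rotate : w ∈ x ∷ ys → w ∈ ys ++ x ∷ []
  rotate (here refl) = ∈-++⁺ʳ ys (here refl)
  rotate (there w∈ys) = ∈-++⁺ˡ w∈ys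
  reach : ∀ y zs → Path s y zs x → w ∈ zs ++ x ∷ [] → ∃ λ u → u ∈ y ∷ zs × s u ≡ w
  reach y []       sy≡x          (here refl)  = y , here refl , sy≡x
  reach y (z ∷ zs) (sy≡z , path) (here refl)  = y , here refl , sy≡z
  reach y (z ∷ zs) (sy≡z , path) (there w∈) with reach z zs path w∈
  ... | u , u∈ , su≡w = u , there u∈ , su≡w

links : ℕ → List ℕ → ℕ → List (ℕ × ℕ)
links x []       z = (x , z) ∷ []
links x (y ∷ ys) z = (x , y) ∷ links y ys z

cyclicLinks : Block → List (ℕ × ℕ)
cyclicLinks (h , T) = links h T h

assoc : List (ℕ × ℕ) → ℕ → ℕ
assoc []            a = 0
assoc ((k , v) ∷ r) a with k ≟ a
... | yes _ = v
... | no  _ = assoc r a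

keys-links : ∀ x ys z → map proj₁ (links x ys z) ≡ x ∷ ys
keys-links x []       z = refl
keys-links x (y ∷ ys) z = cong (x ∷_) (keys-links y ys z)

assoc-∈ : ∀ ps {k v} → Unique (map proj₁ ps) → (k , v) ∈ ps → assoc ps k ≡ v
assoc-∈ ((k , v) ∷ r) _ (here refl) with k ≟ k
... | yes _   = refl
... | no  k≢k = contradiction refl k≢k
assoc-∈ ((k′ , v′) ∷ r) {k} (k′∉ ∷ unique) (there kv∈) with k′ ≟ k
... | yes refl = contradiction refl (All.lookup k′∉ (∈-map⁺ proj₁ kv∈))
... | no  _    = assoc-∈ r unique kv∈

links-Path : ∀ (g : ℕ → ℕ) x ys z → (∀ {k v} → (k , v) ∈ links x ys z → g k ≡ v) → Path g x ys z
links-Path g x []       z table = table (here refl)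
links-Path g x (y ∷ ys) z table = table (here refl) , links-Path g y ys z (table ∘ there)

module Preimage (n : ℕ) {π} (π∈ : π ∈ Sym n) where

  bs : List Block
  bs = blocks π

  successor : ℕ → ℕ
  successor = assoc (concatMap cyclicLinks bs)

  σ : List ℕ
  σ = map successor (range1 n)

  flat⊆π : ∀ {b} → b ∈ bs → flat b ⊆ π
  flat⊆π b∈ = subst (flat _ ⊆_) (blocks-flat π) (flat⊆concatMap-flat bs b∈)

  flat-unique : ∀ {b} → b ∈ bs → Unique (flat b)
  flat-unique b∈ = AllPairs-resp-⊇ (flat⊆π b∈) (Sym⇒unique n π∈)

  flat-length : ∀ {b} → b ∈ bs → length (flat b) ≤ n
  flat-length b∈ = subst (_ ≤_) (Sym⇒length n π∈) (length-mono-≤ (flat⊆π b∈))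

  flat⊆ₛrange1 : ∀ {b} → b ∈ bs → flat b ⊆ₛ range1 n
  flat⊆ₛrange1 b∈ = Sym⇒⊆ₛ n π∈ ∘ Sublist.lookup (flat⊆π b∈)

  ∈-block : ∀ {u} → u ∈ range1 n → ∃ λ b → b ∈ bs × u ∈ flat b
  ∈-block u∈ = find (∈-concatMap⁻ flat (subst (_ ∈_) (sym (blocks-flat π)) (Sym⇒⊇ₛ n π∈ u∈)))

  keys-unique : Unique (map proj₁ (concatMap cyclicLinks bs))
  keys-unique = subst Unique (sym keys) (subst Unique (sym (blocks-flat π)) (Sym⇒unique n π∈))
    where
    keys : map proj₁ (concatMap cyclicLinks bs) ≡ concatMap flat bs
    keys = trans (map-concatMap proj₁ cyclicLinks bs) (concatMap-cong (λ (h , T) → keys-links h T h) bs)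

  successor-Path : ∀ {b} → b ∈ bs → Path successor (proj₁ b) (proj₂ b) (proj₁ b)
  successor-Path {h , T} b∈ = links-Path successor h T h (assoc-∈ (concatMap cyclicLinks bs) keys-unique ∘ inTable)
    where
    inTable : ∀ {kv} → kv ∈ links h T h → kv ∈ concatMap cyclicLinks bs
    inTable kv∈ = ∈-concatMap⁺ cyclicLinks (lose b∈ kv∈)

  σ-Path : ∀ {b} → b ∈ bs → Path (at σ) (proj₁ b) (proj₂ b) (proj₁ b)
  σ-Path {h , T} b∈ = Path-cong h T h (at-map-range1 successor ∘ flat⊆ₛrange1 b∈) (successor-Path b∈)

  cycleOf-head : ∀ {b} → b ∈ bs → cycleOf n σ (proj₁ b) ≡ flat b
  cycleOf-head {h , T} b∈ with flat-unique b∈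
  ... | h∉T ∷ _ = cycleOf-Path n σ h T (σ-Path b∈) (λ h∈T → All.lookup h∉T h∈T refl) (<⇒≤ (flat-length b∈))

  head-IsCycleMax : ∀ {b} → b ∈ bs → IsCycleMax n σ (proj₁ b)
  head-IsCycleMax {h , T} b∈ = subst (All (_≤ h)) (sym (cycleOf-head b∈)) (≤-refl ∷ All.lookup (blocks-bounded π) b∈)

  -- inside a block, the orbit of a non-head entry x passes through the head h ≥ x
  tail-¬IsCycleMax : ∀ {h T x} → (h , T) ∈ bs → x ∈ T → ¬ IsCycleMax n σ x
  tail-¬IsCycleMax {h} {T} {x} b∈ x∈T xMax with ∈-∃++ x∈T
  ... | A , B , refl = h≢x (≤-antisym h≤x (All.lookup (All.lookup (blocks-bounded π) b∈) x∈T))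
    where
    rotation : (h ∷ A) ++ (x ∷ B) ↭ (x ∷ B) ++ (h ∷ A)
    rotation = ++-comm (h ∷ A) (x ∷ B)
    rotated-unique : Unique (x ∷ B ++ h ∷ A)
    rotated-unique = Unique-resp-↭ rotation (flat-unique b∈)
    h≢x : h ≢ x
    h≢x h≡x with flat-unique b∈
    ... | h∉ ∷ _ = All.lookup h∉ (∈-++⁺ʳ A (here refl)) h≡x
    cycle : cycleOf n σ x ≡ x ∷ B ++ h ∷ A
    cycle with rotated-unique
    ... | x∉ ∷ _ = cycleOf-Path n σ x (B ++ h ∷ A) (Path-rotate h A x B (σ-Path b∈))
                     (λ x∈ → All.lookup x∉ x∈ refl) (<⇒≤ (subst (_≤ n) (↭-length rotation) (flat-length b∈)))
    h≤x : h ≤ x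
    h≤x = All.lookup (subst (All (_≤ x)) cycle xMax) (there (∈-++⁺ʳ B (here refl)))

  cycleMaxima≡heads : cycleMaxima n σ ≡ map proj₁ bs
  cycleMaxima≡heads = ⊆-antisym (sorted-⊆ₛ⇒⊆ (cycleMaxima-sorted n σ) (blocks-heads-sorted π) maxima⊆heads)
                                (sorted-⊆ₛ⇒⊆ (blocks-heads-sorted π) (cycleMaxima-sorted n σ) heads⊆maxima)
    where
    maxima⊆heads : cycleMaxima n σ ⊆ₛ map proj₁ bs
    maxima⊆heads m∈ with ∈-cycleMaxima⁻ n σ m∈
    ... | m∈range , mMax with ∈-block m∈range
    ...   | b , b∈ , here refl   = ∈-map⁺ proj₁ b∈
    ...   | b , b∈ , there m∈T   = contradiction mMax (tail-¬IsCycleMax b∈ m∈T)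
    heads⊆maxima : map proj₁ bs ⊆ₛ cycleMaxima n σ
    heads⊆maxima h∈ with ∈-map⁻ proj₁ h∈
    ... | b , b∈ , refl = ∈-filter⁺ _ (flat⊆ₛrange1 b∈ (here refl)) (head-IsCycleMax b∈)

  θσ≡π : θ n σ ≡ π
  θσ≡π = begin
    concatMap (cycleOf n σ) (cycleMaxima n σ)  ≡⟨ cong (concatMap (cycleOf n σ)) cycleMaxima≡heads ⟩
    concatMap (cycleOf n σ) (map proj₁ bs)     ≡⟨ concatMap-map (cycleOf n σ) proj₁ bs ⟩
    concatMap (cycleOf n σ ∘ proj₁) bs         ≡⟨ cong concat (map-cong-local (All.tabulate cycleOf-head)) ⟩
    concatMap flat bs                          ≡⟨ blocks-flat π ⟩
    π                                          ∎
    where open ≡-Reasoning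

  range1⊆ₛσ : range1 n ⊆ₛ σ
  range1⊆ₛσ w∈ with ∈-block w∈
  ... | (h , T) , b∈ , w∈b with Path-onto h T (successor-Path b∈) w∈b
  ...   | u , u∈ , successoru≡w = subst (_∈ σ) successoru≡w (∈-map⁺ successor (flat⊆ₛrange1 b∈ u∈))

  σ∈Sym : σ ∈ Sym n
  σ∈Sym = ↭⇒∈-perms (range1 n) (↭-sym range1↭σ)
    where
    range1↭σ : range1 n ↭ σ
    range1↭σ = unique-⊆ₛ-length⇒↭ (sorted⇒unique (range1-sorted n)) range1⊆ₛσ (sym (length-map successor (range1 n)))

θ∘hat : ∀ n {π} → π ∈ Sym n → θ n (hat n π) ≡ π
θ∘hat n {π} π∈ = firstD-filter (λ σ → ≡-dec _≟_ (θ n σ) π) (Preimage.σ∈Sym n π∈) (Preimage.θσ≡π n π∈)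

module _ (n : ℕ) {π} (π∈ : π ∈ Sym n) where

  private
    σ : List ℕ
    σ = hat n π

    maxima : All (IsCycleMax n σ) (cycleMaxima n σ)
    maxima = All.tabulate (proj₂ ∘ ∈-cycleMaxima⁻ n σ)

  contains⇒NonRLMaxDescent : Contains n π pat13-2→1 → NonRLMaxDescent π
  contains⇒NonRLMaxDescent c with find c
  ... | X , X∈ , occurrence = fromTriple X (∈-choose⁻ 3 (range1 n) X∈) occurrence
    where
    fromTriple : ∀ X → X ⊆ range1 n × length X ≡ 3 → Occurs n π pat13-2→1 X → NonRLMaxDescent π
    fromTriple (x₁ ∷ x₂ ∷ x₃ ∷ []) (X⊆ , refl) (x₁x₃⊆π , (σx₂≡x₁ ∷ []))
      with AllPairs-resp-⊇ X⊆ (range1-sorted n)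
    ... | (x₁<x₂ ∷ _) ∷ (x₂<x₃ ∷ []) ∷ [] ∷ [] = record
      { adjacent = subst (Adjacent x₂ x₁) (θ∘hat n π∈) (subst (λ v → Adjacent x₂ v (θ n σ)) σx₂≡x₁ adjacentInθ)
      ; descent  = x₁<x₂
      ; exceeded = x₂<x₃
      ; followed = x₁x₃⊆π
      }
      where
      x₂∈θ : x₂ ∈ θ n σ
      x₂∈θ = subst (x₂ ∈_) (sym (θ∘hat n π∈)) (Sym⇒⊇ₛ n π∈ (Sublist.lookup X⊆ (there (here refl))))
      adjacentInθ : Adjacent x₂ (at σ x₂) (θ n σ)
      adjacentInθ = step⇒adjacent n σ maxima x₂∈θ (subst (_< x₂) (sym σx₂≡x₁) x₁<x₂)
                      (≤-reflexive (trans (cong length (θ∘hat n π∈)) (Sym⇒length n π∈)))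

  NonRLMaxDescent⇒contains : NonRLMaxDescent π → Contains n π pat13-2→1
  NonRLMaxDescent⇒contains d = lose X∈ (followed , (σtop≡bottom ∷ []))
    where
    open NonRLMaxDescent d
    X⊆ₛ : bottom ∷ top ∷ larger ∷ [] ⊆ₛ range1 n
    X⊆ₛ (here refl)                 = Sym⇒⊆ₛ n π∈ (proj₂ (Adjacent-∈ adjacent))
    X⊆ₛ (there (here refl))         = Sym⇒⊆ₛ n π∈ (proj₁ (Adjacent-∈ adjacent))
    X⊆ₛ (there (there (here refl))) = Sym⇒⊆ₛ n π∈ (Sublist.lookup followed (there (here refl)))
    X∈ : bottom ∷ top ∷ larger ∷ [] ∈ choose 3 (range1 n)
    X∈ = ∈-choose⁺ (sorted-⊆ₛ⇒⊆ X-sorted (range1-sorted n) X⊆ₛ)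
      where
      X-sorted : AllPairs _<_ (bottom ∷ top ∷ larger ∷ [])
      X-sorted = (descent ∷ <-trans descent exceeded ∷ []) ∷ (exceeded ∷ []) ∷ [] ∷ []
    σtop≡bottom : at σ top ≡ bottom
    σtop≡bottom = descent⇒step n σ (cycleMaxima-sorted n σ) maxima
                    (subst (Adjacent top bottom) (sym (θ∘hat n π∈)) adjacent) descent

  avoids⇔descentTopsRLMax : (¬ Contains n π pat13-2→1) ⇔ (descentTopsRLMax π ≡ true)
  avoids⇔descentTopsRLMax = mk⇔ to from
    where
    to : ¬ Contains n π pat13-2→1 → descentTopsRLMax π ≡ true
    to avoids with descentTopsRLMax π in good
    ... | true  = refl
    ... | false = contradiction (NonRLMaxDescent⇒contains (descentTopsRLMax-false⇒NonRLMaxDescent π good)) avoids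
    from : descentTopsRLMax π ≡ true → ¬ Contains n π pat13-2→1
    from good c =
      contradiction (trans (sym good) (NonRLMaxDescent⇒descentTopsRLMax-false (Sym⇒unique n π∈) (contains⇒NonRLMaxDescent c)))
                    λ ()

theorem5p2 : (n : ℕ) → 1 ≤ n → avoidCount n pat13-2→1 ≡ Bell n
theorem5p2 n _ = begin
  avoidCount n pat13-2→1
    ≡⟨ length-filter≡sum-𝟙 _ descentTopsRLMax (Sym n) (avoids⇔descentTopsRLMax n) ⟩
  sum (map (𝟙 ∘ descentTopsRLMax) (Sym n))
    ≡⟨ count-descentTopsRLMax-Sym n ⟩
  Bell n ∎
  where open ≡-Reasoning
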